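{- Fix an integer $k>2$. The coloring $c$ is regressive on the interval $[4k^2,f_k(4k^2))$: for all integers $m,n$ with $4k^2\le m<n<f_k(4k^2)$, one has $c(\{m,n\})<m$.
   Context: For a function $f:\mathbb N\to\mathbb N$, $f^{(0)}(x)=x$ and $f^{(n+1)}(x)=f(f^{(n)}(x))$. Define $f_i:\mathbb N\to\mathbb N$ for $i\ge1$ by $f_1(n)=n+1$ and $f_{i+1}(n)=f_i^{(\lfloor\sqrt n/2\rfloor)}(n)$. With $k>2$ fixed, for $m,n\ge 4k^2$ and $i\ge1$ let $d_i(m,n)=|\{l\in\mathbb N: m<f_i^{(l)}(4k^2)\le n\}|$. For $n>m\ge 4k^2$, let $I(m,n)$ be the greatest $i\ge1$ for which $d_i(m,n)>0$, and $d(m,n)=d_{I(m,n)}(m,n)$. Let $\operatorname{Pr}(a,b)=\binom{a+b+1}{2}+b$. Define $c(\{m,n\})=\operatorname{Pr}(I(m,n),d(m,n))$ for $4k^2\le m<n$. -}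

module Defs where

open import Data.Nat using (ℕ; zero; suc; _+_; _*_; _/_; _<_; _≤_; _<ᵇ_; _≤ᵇ_)
open import Data.Nat.Combinatorics using (_C_)
open import Data.Bool using (Bool; true; false; if_then_else_; _∧_)
open import Data.List using (List; length; filter; upTo)
open import Relation.Nullary.Decidable using (yes; no)
open import Data.Bool.Properties using (T?)

iter : (ℕ → ℕ) → ℕ → ℕ → ℕ
iter f zero    x = x
iter f (suc n) x = f (iter f n x)

isqrt : ℕ → ℕ
isqrt zero    = zero
isqrt (suc n) = let s = isqrt n in
  if (suc s * suc s) ≤ᵇ suc n then suc s else s

-- f i = f_i for i ≥ 1 ; f 0 is unused junk (set equal to successor)
-- ⌊√n / 2⌋ = ⌊⌊√n⌋ / 2⌋
f : ℕ → ℕ → ℕ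
f zero          n = suc n
f (suc zero)    n = suc n
f (suc (suc i)) n = iter (f (suc i)) (isqrt n / 2) n

base : ℕ → ℕ
base k = 4 * (k * k)

-- d_i(m,n) = |{ l : m < f_i^(l)(4k²) ≤ n }|.
-- Since f_i(x) > x for x ≥ 4, f_i^(l)(4k²) ≥ 4k² + l, so any such l is < n;
-- counting over l ∈ {0,…,n} therefore counts the whole set.
d : ℕ → ℕ → ℕ → ℕ → ℕ
d k i m n = length (filter (λ l → T? ((m <ᵇ iter (f i) l (base k)) ∧ (iter (f i) l (base k) ≤ᵇ n))) (upTo (suc n)))

findI : ℕ → ℕ → ℕ → ℕ → ℕ
findI k m n zero    = 1
findI k m n (suc j) = if 0 <ᵇ d k (suc j) m n then suc j else findI k m n j

-- I(m,n): d_i(m,n) > 0 forces f_i(4k²) ≤ n, and f_i(4k²) ≥ 4k² + i, so i ≤ n.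
I : ℕ → ℕ → ℕ → ℕ
I k m n = findI k m n n

dI : ℕ → ℕ → ℕ → ℕ
dI k m n = d k (I k m n) m n

Pr : ℕ → ℕ → ℕ
Pr a b = ((a + b + 1) C 2) + b

c : ℕ → ℕ → ℕ → ℕ
c k m n = Pr (I k m n) (dI k m n)

{-# OPTIONS --safe #-}
-- Let q = ⌊√m⌋/2; from 4k² ≤ m we get k ≤ q. Every f_i with i ≥ k jumps from 4k² straight past n,
-- so I = I(m,n) < k ≤ q. By maximality of I no f_{I+1}-orbit point of 4k² lies in (m, n], so (m, n]
-- lies inside a single step x ↦ f_{I+1}(x) = f_I^(⌊√x⌋/2)(x) with x ≤ m. Since the f_{I+1}-orbit is
-- part of the f_I-orbit, this gives d(m,n) ≤ ⌊√x⌋/2 ≤ q. Hence I + d + 1 ≤ 2q ≤ ⌊√m⌋, and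
-- Pr(I, d) < (I + d + 1)² ≤ m.
module Submission where

open import Defs
open import Data.Nat using (ℕ; zero; suc; _+_; _*_; _∸_; _/_; _⊓_; _<_; _≤_; _<ᵇ_; _≤ᵇ_; z≤n; s≤s)
open import Data.Nat.Properties
open import Data.Nat.DivMod using (m*n/n≡m; m/n*n≤m; /-monoˡ-≤)
open import Data.Nat.Combinatorics using (_C_; nC1≡n; nCk+nC[k+1]≡[n+1]C[k+1])
open import Data.Nat.Tactic.RingSolver using (solve-∀)
open import Data.Bool using (T; true; false; _∧_)
open import Data.Bool.Properties using (T?; T-∧; T-≡)
open import Data.List using (length; filter; upTo; _++_; [_])
open import Data.List.Properties using (length-++; filter-++; filter-accept; filter-reject; filter-none; upTo-∷ʳ)
open import Data.List.Membership.Propositional.Properties using (∈-filter⁺; ∈-upTo⁺; ∈-length)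
open import Data.List.Relation.Unary.All using (universal)
open import Data.Product as Product using (_×_; _,_; proj₁; proj₂; ∃-syntax)
open import Data.Empty using (⊥-elim)
open import Data.Sum using (inj₁; inj₂)
open import Function using (_∘_; Equivalence)
open import Relation.Nullary using (¬_; yes; no)
open import Relation.Unary using (Pred; Decidable)
open import Relation.Binary.PropositionalEquality using (_≡_; refl; sym; trans; cong; subst; module ≡-Reasoning)

module _ {p} {P : Pred ℕ p} (P? : Decidable P) where

  length-filter-upTo-suc : ∀ N → length (filter P? (upTo (suc N))) ≡ length (filter P? (upTo N)) + length (filter P? [ N ])
  length-filter-upTo-suc N = begin
      length (filter P? (upTo (suc N)))                       ≡⟨ cong (length ∘ filter P?) (upTo-∷ʳ N) ⟨
      length (filter P? (upTo N ++ [ N ]))                    ≡⟨ cong length (filter-++ P? (upTo N) [ N ]) ⟩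
      length (filter P? (upTo N) ++ filter P? [ N ])          ≡⟨ length-++ (filter P? (upTo N)) ⟩
      length (filter P? (upTo N)) + length (filter P? [ N ])  ∎
    where open ≡-Reasoning

  length-filter-upTo-≤ : ∀ {lo hi} → (∀ {l} → P l → lo ≤ l × l < hi) → ∀ N → length (filter P? (upTo N)) ≤ hi ∸ lo
  length-filter-upTo-≤ {lo} {hi} window N = ≤-trans (bounded N) (∸-monoˡ-≤ lo (m⊓n≤n N hi))
    where
      open ≤-Reasoning
      count : ℕ → ℕ
      count N = length (filter P? (upTo N))
      bounded : ∀ N → count N ≤ (N ⊓ hi) ∸ lo
      bounded zero = z≤n
      bounded (suc N) with P? N
      ... | yes PN = let lo≤N , N<hi = window PN in begin
        count (suc N)                        ≡⟨ length-filter-upTo-suc N ⟩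
        count N + length (filter P? [ N ])   ≡⟨ cong (λ xs → count N + length xs) (filter-accept P? PN) ⟩
        count N + 1                          ≤⟨ +-monoˡ-≤ 1 (bounded N) ⟩
        (N ⊓ hi) ∸ lo + 1                    ≡⟨ cong (λ t → t ∸ lo + 1) (m≤n⇒m⊓n≡m (<⇒≤ N<hi)) ⟩
        N ∸ lo + 1                           ≡⟨ +-comm (N ∸ lo) 1 ⟩
        1 + (N ∸ lo)                         ≡⟨ +-∸-assoc 1 lo≤N ⟨
        suc N ∸ lo                           ≡⟨ cong (_∸ lo) (m≤n⇒m⊓n≡m N<hi) ⟨
        (suc N ⊓ hi) ∸ lo                    ∎
      ... | no ¬PN = begin
        count (suc N)                        ≡⟨ length-filter-upTo-suc N ⟩
        count N + length (filter P? [ N ])   ≡⟨ cong (λ xs → count N + length xs) (filter-reject P? ¬PN) ⟩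
        count N + 0                          ≡⟨ +-identityʳ (count N) ⟩
        count N                              ≤⟨ bounded N ⟩
        (N ⊓ hi) ∸ lo                        ≤⟨ ∸-monoˡ-≤ lo (⊓-monoˡ-≤ hi (n≤1+n N)) ⟩
        (suc N ⊓ hi) ∸ lo                    ∎

iter-+ : ∀ (h : ℕ → ℕ) a c y → iter h (a + c) y ≡ iter h a (iter h c y)
iter-+ h zero    c y = refl
iter-+ h (suc a) c y = cong h (iter-+ h a c y)

module _ {h : ℕ → ℕ} where

  iter-inflationary : (∀ y → y ≤ h y) → ∀ s y → y ≤ iter h s y
  iter-inflationary h-infl zero    y = ≤-refl
  iter-inflationary h-infl (suc s) y = ≤-trans (iter-inflationary h-infl s y) (h-infl _)

  iter-monoˡ-≤ : (∀ y → y ≤ h y) → ∀ {s t} y → s ≤ t → iter h s y ≤ iter h t y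
  iter-monoˡ-≤ h-infl {s} {t} y s≤t = begin
      iter h s y                    ≤⟨ iter-inflationary h-infl (t ∸ s) _ ⟩
      iter h (t ∸ s) (iter h s y)   ≡⟨ iter-+ h (t ∸ s) s y ⟨
      iter h (t ∸ s + s) y          ≡⟨ cong (λ u → iter h u y) (m∸n+n≡m s≤t) ⟩
      iter h t y                    ∎
    where open ≤-Reasoning

  iter-monoʳ-≤ : (∀ {y y′} → y ≤ y′ → h y ≤ h y′) → ∀ s {y y′} → y ≤ y′ → iter h s y ≤ iter h s y′
  iter-monoʳ-≤ h-mono zero    y≤y′ = y≤y′
  iter-monoʳ-≤ h-mono (suc s) y≤y′ = h-mono (iter-monoʳ-≤ h-mono s y≤y′)

  iter-expanding : ∀ {c} → (∀ {y} → c ≤ y → y < h y) → ∀ s {y} → c ≤ y → s + y ≤ iter h s y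
  iter-expanding h-exp zero    c≤y = ≤-refl
  iter-expanding h-exp (suc s) {y} c≤y = ≤-<-trans ih (h-exp (≤-trans c≤y (≤-trans (m≤n+m y s) ih)))
    where
      ih : s + y ≤ iter h s y
      ih = iter-expanding h-exp s c≤y

iter-bracket : ∀ (g : ℕ → ℕ) {b m} F → b ≤ m → m < iter g F b → ∃[ j ] iter g j b ≤ m × m < iter g (suc j) b
iter-bracket g zero    b≤m m<b = ⊥-elim (<⇒≱ m<b b≤m)
iter-bracket g {b} {m} (suc F) b≤m m<gᶠ⁺¹b with m <? iter g F b
... | yes m<gᶠb = iter-bracket g F b≤m m<gᶠb
... | no  m≮gᶠb = F , ≮⇒≥ m≮gᶠb , m<gᶠ⁺¹b

isqrt-bounds : ∀ n → isqrt n * isqrt n ≤ n × n < suc (isqrt n) * suc (isqrt n)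
isqrt-bounds zero    = z≤n , s≤s z≤n
isqrt-bounds (suc n) with isqrt-bounds n | suc (isqrt n) * suc (isqrt n) ≤ᵇ suc n in step
... | _ , n<[1+r]² | true  = ≤ᵇ⇒≤ _ _ (Equivalence.from T-≡ step) ,
                             ≤-trans (s≤s n<[1+r]²) (*-mono-< (n<1+n (suc (isqrt n))) (n<1+n (suc (isqrt n))))
... | r²≤n , _      | false = m≤n⇒m≤1+n r²≤n , ≰⇒> (λ [1+r]²≤1+n → subst T step (≤⇒≤ᵇ [1+r]²≤1+n))

m*m≤n⇒m≤isqrt[n] : ∀ {m n} → m * m ≤ n → m ≤ isqrt n
m*m≤n⇒m≤isqrt[n] {n = n} m²≤n = ≮⇒≥ λ r<m → <⇒≱ (proj₂ (isqrt-bounds n)) (≤-trans (*-mono-≤ r<m r<m) m²≤n)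

isqrt-mono-≤ : ∀ {m n} → m ≤ n → isqrt m ≤ isqrt n
isqrt-mono-≤ {m} m≤n = m*m≤n⇒m≤isqrt[n] (≤-trans (proj₁ (isqrt-bounds m)) m≤n)

base≤n⇒k≤isqrt[n]/2 : ∀ {k n} → base k ≤ n → k ≤ isqrt n / 2
base≤n⇒k≤isqrt[n]/2 {k} {n} 4k²≤n = begin
    k                ≡⟨ m*n/n≡m k 2 ⟨
    k * 2 / 2        ≤⟨ /-monoˡ-≤ 2 (m*m≤n⇒m≤isqrt[n] {k * 2} (≤-trans (≤-reflexive (square-double k)) 4k²≤n)) ⟩
    isqrt n / 2      ∎
  where
    open ≤-Reasoning
    square-double : ∀ k → (k * 2) * (k * 2) ≡ 4 * (k * k)
    square-double = solve-∀

f-inflationary : ∀ i y → y ≤ f i y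
f-inflationary zero          y = n≤1+n y
f-inflationary (suc zero)    y = n≤1+n y
f-inflationary (suc (suc i)) y = iter-inflationary (f-inflationary (suc i)) (isqrt y / 2) y

f-mono-≤ : ∀ i {y y′} → y ≤ y′ → f i y ≤ f i y′
f-mono-≤ zero          y≤y′ = s≤s y≤y′
f-mono-≤ (suc zero)    y≤y′ = s≤s y≤y′
f-mono-≤ (suc (suc i)) {y} {y′} y≤y′ = begin
    iter (f (suc i)) (isqrt y / 2) y    ≤⟨ iter-monoʳ-≤ (f-mono-≤ (suc i)) (isqrt y / 2) y≤y′ ⟩
    iter (f (suc i)) (isqrt y / 2) y′   ≤⟨ iter-monoˡ-≤ (f-inflationary (suc i)) y′ (/-monoˡ-≤ 2 (isqrt-mono-≤ y≤y′)) ⟩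
    iter (f (suc i)) (isqrt y′ / 2) y′  ∎
  where open ≤-Reasoning

-- base 1 = 4, so ⌊√y⌋/2 ≥ 1: f_{i+2} takes at least one step of f_{i+1}.
f[1+i]≤f[2+i] : ∀ i {y} → 4 ≤ y → f (suc i) y ≤ f (suc (suc i)) y
f[1+i]≤f[2+i] i {y} 4≤y with isqrt y / 2 | base≤n⇒k≤isqrt[n]/2 {1} 4≤y
... | suc s | _ = f-mono-≤ (suc i) (iter-inflationary (f-inflationary (suc i)) s y)

n<f[1+i]n : ∀ i {y} → 4 ≤ y → y < f (suc i) y
n<f[1+i]n zero    4≤y = ≤-refl
n<f[1+i]n (suc i) 4≤y = <-≤-trans (n<f[1+i]n i 4≤y) (f[1+i]≤f[2+i] i 4≤y)

f-monoˡ-≤ : ∀ {i j y} → 4 ≤ y → i ≤ j → f (suc i) y ≤ f (suc j) y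
f-monoˡ-≤ {j = zero} _ z≤n = ≤-refl
f-monoˡ-≤ {i} {suc j} 4≤y i≤1+j with m≤n⇒m<n∨m≡n i≤1+j
... | inj₁ i<1+j = ≤-trans (f-monoˡ-≤ 4≤y (≤-pred i<1+j)) (f[1+i]≤f[2+i] j 4≤y)
... | inj₂ refl  = ≤-refl

iter-f[2+i]-suc : ∀ i j L {y} → iter (f (2 + i)) j y ≡ iter (f (1 + i)) L y →
                  iter (f (2 + i)) (suc j) y ≡ iter (f (1 + i)) (isqrt (iter (f (2 + i)) j y) / 2 + L) y
iter-f[2+i]-suc i j L {y} gʲy≡hᴸy =
  trans (cong (iter (f (1 + i)) s) gʲy≡hᴸy) (sym (iter-+ (f (1 + i)) s L y))
  where
    s : ℕ
    s = isqrt (iter (f (2 + i)) j y) / 2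

f[2+i]-orbit⊆f[1+i]-orbit : ∀ i j y → ∃[ L ] iter (f (2 + i)) j y ≡ iter (f (1 + i)) L y
f[2+i]-orbit⊆f[1+i]-orbit i zero    y = 0 , refl
f[2+i]-orbit⊆f[1+i]-orbit i (suc j) y with L , gʲy≡hᴸy ← f[2+i]-orbit⊆f[1+i]-orbit i j y =
  isqrt (iter (f (2 + i)) j y) / 2 + L , iter-f[2+i]-suc i j L gʲy≡hᴸy

4≤base : ∀ {k} → 1 ≤ k → 4 ≤ base k
4≤base {suc k} _ = m≤m*n 4 (suc k * suc k)

k≤base : ∀ k → k ≤ base k
k≤base zero    = z≤n
k≤base (suc k) = ≤-trans (m≤m*n (suc k) (suc k)) (m≤n*m (suc k * suc k) 4)

window? : ∀ k i m n → Decidable (λ l → T ((m <ᵇ iter (f i) l (base k)) ∧ (iter (f i) l (base k) ≤ᵇ n)))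
window? k i m n l = T? ((m <ᵇ iter (f i) l (base k)) ∧ (iter (f i) l (base k) ≤ᵇ n))

T-window⁻ : ∀ {m n x} → T ((m <ᵇ x) ∧ (x ≤ᵇ n)) → m < x × x ≤ n
T-window⁻ {m} {n} {x} = Product.map (<ᵇ⇒< m x) (≤ᵇ⇒≤ x n) ∘ Equivalence.to T-∧

T-window⁺ : ∀ {m n x} → m < x → x ≤ n → T ((m <ᵇ x) ∧ (x ≤ᵇ n))
T-window⁺ m<x x≤n = Equivalence.from T-∧ (<⇒<ᵇ m<x , ≤⇒≤ᵇ x≤n)

d-positive : ∀ {k i m n} l → l ≤ n → m < iter (f i) l (base k) → iter (f i) l (base k) ≤ n → 0 < d k i m n
d-positive {k} {i} {m} {n} l l≤n m<x x≤n =
  ∈-length (∈-filter⁺ (window? k i m n) (∈-upTo⁺ (s≤s l≤n)) (T-window⁺ m<x x≤n))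

d≡0⇒orbit-skips-window : ∀ {k i m n} l → 1 ≤ k → d k (suc i) m n ≡ 0 →
                         m < iter (f (suc i)) l (base k) → n < iter (f (suc i)) l (base k)
d≡0⇒orbit-skips-window {k} {i} {m} {n} l 1≤k d≡0 m<x = ≰⇒> λ x≤n →
  <⇒≢ (d-positive {k} {suc i} l (≤-trans (m≤m+n l (base k)) (≤-trans l+b≤x x≤n)) m<x x≤n) (sym d≡0)
  where
    l+b≤x : l + base k ≤ iter (f (suc i)) l (base k)
    l+b≤x = iter-expanding (n<f[1+i]n i) l (4≤base 1≤k)

d≡0-from-k : ∀ {k m n} → 1 ≤ k → base k ≤ m → n < f k (base k) → ∀ i → k ≤ i → d k i m n ≡ 0
d≡0-from-k {suc k} {m} {n} 1≤k b≤m n<fₖb (suc i) k≤i =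
  cong length (filter-none (window? (suc k) (suc i) m n) (universal outside (upTo (suc n))))
  where
    b : ℕ
    b = base (suc k)
    outside : ∀ l → ¬ T ((m <ᵇ iter (f (suc i)) l b) ∧ (iter (f (suc i)) l b ≤ᵇ n))
    outside zero    t = <⇒≱ (proj₁ (T-window⁻ {n = n} t)) b≤m
    outside (suc l) t = <⇒≱ n<fₖb (begin
      f (suc k) b                           ≤⟨ f-monoˡ-≤ (4≤base 1≤k) (≤-pred k≤i) ⟩
      f (suc i) b                           ≤⟨ f-mono-≤ (suc i) (iter-inflationary (f-inflationary (suc i)) l b) ⟩
      f (suc i) (iter (f (suc i)) l b)      ≤⟨ proj₂ (T-window⁻ t) ⟩
      n                                     ∎)
      where open ≤-Reasoning

-- (m, n] lies inside a single step of f_{i+2}, which consists of at most ⌊√m⌋/2 steps of f_{i+1}.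
d≤isqrt/2-inside-bracket : ∀ k i {m n} j L → iter (f (2 + i)) j (base k) ≡ iter (f (1 + i)) L (base k) →
                           iter (f (2 + i)) j (base k) ≤ m → n < iter (f (2 + i)) (suc j) (base k) →
                           d k (1 + i) m n ≤ isqrt m / 2
d≤isqrt/2-inside-bracket k i {m} {n} j L gʲb≡hᴸb gʲb≤m n<gʲ⁺¹b = begin
    d k (1 + i) m n  ≤⟨ length-filter-upTo-≤ (window? k (1 + i) m n) indices (suc n) ⟩
    (s + L) ∸ L      ≡⟨ m+n∸n≡m s L ⟩
    s                ≤⟨ /-monoˡ-≤ 2 (isqrt-mono-≤ gʲb≤m) ⟩
    isqrt m / 2      ∎
  where
    open ≤-Reasoning
    b : ℕ
    b = base k
    h : ℕ → ℕ
    h = f (1 + i)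
    s : ℕ
    s = isqrt (iter (f (2 + i)) j b) / 2
    n<hˢ⁺ᴸb : n < iter h (s + L) b
    n<hˢ⁺ᴸb = subst (n <_) (iter-f[2+i]-suc i j L gʲb≡hᴸb) n<gʲ⁺¹b
    indices : ∀ {l} → T ((m <ᵇ iter h l b) ∧ (iter h l b ≤ᵇ n)) → L ≤ l × l < s + L
    indices t with m<hˡb , hˡb≤n ← T-window⁻ t =
      ≮⇒≥ (λ l<L → <⇒≱ m<hˡb (≤-trans (iter-monoˡ-≤ (f-inflationary (1 + i)) b (<⇒≤ l<L))
                                       (subst (_≤ m) gʲb≡hᴸb gʲb≤m))) ,
      ≰⇒> (λ s+L≤l → <⇒≱ n<hˢ⁺ᴸb (≤-trans (iter-monoˡ-≤ (f-inflationary (1 + i)) b s+L≤l) hˡb≤n))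

d≤isqrt/2 : ∀ {k m n i} → 1 ≤ i → 1 ≤ k → base k ≤ m → d k (suc i) m n ≡ 0 → d k i m n ≤ isqrt m / 2
d≤isqrt/2 {k} {m} {i = suc i} _ 1≤k b≤m d≡0
  with j , gʲb≤m , m<gʲ⁺¹b ← iter-bracket (f (2 + i)) (suc m) b≤m
         (≤-trans (m≤m+n (suc m) (base k)) (iter-expanding (n<f[1+i]n (suc i)) (suc m) (4≤base 1≤k)))
  with L , gʲb≡hᴸb ← f[2+i]-orbit⊆f[1+i]-orbit i j (base k)
  = d≤isqrt/2-inside-bracket k i j L gʲb≡hᴸb gʲb≤m
      (d≡0⇒orbit-skips-window {i = suc i} (suc j) 1≤k d≡0 m<gʲ⁺¹b)

findI-positive : ∀ k m n J → 1 ≤ findI k m n J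
findI-positive k m n zero    = ≤-refl
findI-positive k m n (suc J) with 0 <ᵇ d k (suc J) m n
... | true  = s≤s z≤n
... | false = findI-positive k m n J

findI-maximal : ∀ k m n J {i} → findI k m n J < i → i ≤ J → d k i m n ≡ 0
findI-maximal k m n zero    () z≤n
findI-maximal k m n (suc J) I<i i≤1+J with 0 <ᵇ d k (suc J) m n in test
... | true  = ⊥-elim (<⇒≱ I<i i≤1+J)
... | false with m≤n⇒m<n∨m≡n i≤1+J
...   | inj₁ i<1+J = findI-maximal k m n J I<i (≤-pred i<1+J)
...   | inj₂ refl  = n≤0⇒n≡0 (≮⇒≥ λ 0<d → subst T test (<⇒<ᵇ 0<d))

findI<bound : ∀ k m n J {t} → 1 < t → (∀ i → t ≤ i → d k i m n ≡ 0) → findI k m n J < t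
findI<bound k m n zero    1<t _ = 1<t
findI<bound k m n (suc J) 1<t vanish with 0 <ᵇ d k (suc J) m n in test
... | true  = ≰⇒> λ t≤1+J → <⇒≢ (<ᵇ⇒< 0 _ (Equivalence.from T-≡ test)) (sym (vanish (suc J) t≤1+J))
... | false = findI<bound k m n J 1<t vanish

nC2+n≤n*n : ∀ n → n C 2 + n ≤ n * n
nC2+n≤n*n zero    = z≤n
nC2+n≤n*n (suc n) = begin
    suc n C 2 + suc n          ≡⟨ cong (_+ suc n) (nCk+nC[k+1]≡[n+1]C[k+1] n 1) ⟨
    n C 1 + n C 2 + suc n      ≡⟨ cong (λ t → t + n C 2 + suc n) (nC1≡n n) ⟩
    n + n C 2 + suc n          ≡⟨ +-suc (n + n C 2) n ⟩
    suc (n + n C 2 + n)        ≡⟨ cong suc (+-assoc n (n C 2) n) ⟩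
    suc (n + (n C 2 + n))      ≤⟨ s≤s (+-monoʳ-≤ n (nC2+n≤n*n n)) ⟩
    suc (n + n * n)            ≤⟨ s≤s (+-monoʳ-≤ n (*-monoʳ-≤ n (n≤1+n n))) ⟩
    suc n * suc n              ∎
  where open ≤-Reasoning

Pr<[a+b+1]² : ∀ a b → Pr a b < (a + b + 1) * (a + b + 1)
Pr<[a+b+1]² a b = begin-strict
    (a + b + 1) C 2 + b             <⟨ +-monoʳ-< ((a + b + 1) C 2) b<a+b+1 ⟩
    (a + b + 1) C 2 + (a + b + 1)   ≤⟨ nC2+n≤n*n (a + b + 1) ⟩
    (a + b + 1) * (a + b + 1)       ∎
  where
    open ≤-Reasoning
    b<a+b+1 : b < a + b + 1
    b<a+b+1 = ≤-trans (s≤s (m≤n+m b a)) (≤-reflexive (+-comm 1 (a + b)))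

Pr<m : ∀ {a b m} → a < isqrt m / 2 → b ≤ isqrt m / 2 → Pr a b < m
Pr<m {a} {b} {m} a<q b≤q = begin-strict
    Pr a b                     <⟨ Pr<[a+b+1]² a b ⟩
    (a + b + 1) * (a + b + 1)  ≤⟨ *-mono-≤ a+b+1≤r a+b+1≤r ⟩
    isqrt m * isqrt m          ≤⟨ proj₁ (isqrt-bounds m) ⟩
    m                          ∎
  where
    open ≤-Reasoning
    double : ∀ q → q + q ≡ q * 2
    double = solve-∀
    a+b+1≤r : a + b + 1 ≤ isqrt m
    a+b+1≤r = begin
      a + b + 1                    ≡⟨ +-comm (a + b) 1 ⟩
      suc a + b                    ≤⟨ +-mono-≤ a<q b≤q ⟩
      isqrt m / 2 + isqrt m / 2    ≡⟨ double (isqrt m / 2) ⟩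
      isqrt m / 2 * 2              ≤⟨ m/n*n≤m (isqrt m) 2 ⟩
      isqrt m                      ∎

mainTheorem4 : (k : ℕ) → 2 < k → (m n : ℕ) → base k ≤ m → m < n → n < f k (base k) → c k m n < m
mainTheorem4 k 2<k m n b≤m m<n n<fₖb = Pr<m I<isqrt[m]/2 (d≤isqrt/2 (findI-positive k m n n) 1≤k b≤m d[1+I]≡0)
  where
    1<k : 1 < k
    1<k = <⇒≤ 2<k
    1≤k : 1 ≤ k
    1≤k = <⇒≤ 1<k
    I<k : I k m n < k
    I<k = findI<bound k m n n 1<k (d≡0-from-k 1≤k b≤m n<fₖb)
    I<isqrt[m]/2 : I k m n < isqrt m / 2
    I<isqrt[m]/2 = <-≤-trans I<k (base≤n⇒k≤isqrt[n]/2 b≤m)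
    d[1+I]≡0 : d k (suc (I k m n)) m n ≡ 0
    d[1+I]≡0 = findI-maximal k m n n ≤-refl (≤-trans I<k (≤-trans (k≤base k) (≤-trans b≤m (<⇒≤ m<n))))
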